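{- (i) For every cyclic formula $\phi$, $\mathsf{CHL}\vdash\phi\leftrightarrow\langle\phi/\phi\rangle$. (ii) For every cyclic formula $\psi$ modalised in $p$, $\mathsf{CHL}\vdash\digamma p.\psi\leftrightarrow\psi[p:\digamma p.\psi]$.
   Context: Labels: $\bot,\top$ and propositional variables (arity 0), $\neg,\Box$ (arity 1), $\wedge,\vee,\to$ (arity 2). A graph is $\langle V,r,S,\lambda\rangle$ with $V$ finite, root $r$, labelling $\lambda$, $S:V\to V^{*}$ ordered successors (length = arity of label); every vertex reachable from $r$. A cycle is a set of pairwise distinct vertices each followed by a successor, closing up. A (cyclic) formula is a graph in which every cycle contains a $\Box$-labelled vertex. Bisimulation: $aRa'$ implies equal labels and $i$-th successors related; $\simeq$ = bisimilarity relating roots. $\phi[p:\psi]$: disjoint union identifying each $p$-labelled vertex of $\phi$ with the root of $\psi$ (keeping that root's label). $\psi$ modalised in $p$: every path from root to a $p$-labelled vertex contains a $\Box$-labelled vertex; $\digamma p.\psi$ identifies the root with all $p$-labelled vertices (keeping the root's label). For $q$ not occurring in $\phi$: if the root $r$ of $\phi$ is on no cycle, $\langle\phi/q\rangle:=\phi$; otherwise add a fresh vertex labelled $q$ without successors and redirect every edge into $r$ to it (root still $r$). $\langle\phi/\chi\rangle:=\langle\phi/q\rangle[q:\chi]$. $\mathsf{CHL}$: least set of cyclic formulas containing all substitution instances of propositional tautologies, all $\Box(\phi\to\psi)\to(\Box\phi\to\Box\psi)$, all $\phi\leftrightarrow\psi$ with $\phi\simeq\psi$, closed under modus ponens, necessitation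 and Löb's rule (from $\vdash\Box\phi\to\phi$ infer $\vdash\phi$). -}

module Defs where

open import Data.Nat using (ℕ; zero; suc; _+_; _≡ᵇ_)
open import Data.Fin using (Fin; zero; suc; splitAt; _↑ˡ_; _↑ʳ_; _≟_)
open import Data.Bool using (Bool; true; false; if_then_else_)
open import Data.Vec using (Vec; []; _∷_; map; lookup)
open import Data.List using (List; []; _∷_; _∷ʳ_)
open import Data.List.Relation.Unary.Unique.Propositional using (Unique)
open import Data.List.Relation.Unary.Linked using (Linked)
open import Data.List.Relation.Unary.Any using (Any)
open import Data.List.Membership.Propositional using (_∈_)
open import Data.Sum using (_⊎_; inj₁; inj₂; [_,_]′)
open import Data.Product using (Σ; ∃; _×_; _,_)
open import Data.Empty using (⊥)
open import Relation.Nullary using (Dec; yes; no; ¬_)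
open import Relation.Nullary.Decidable using (⌊_⌋)
open import Relation.Binary.PropositionalEquality using (_≡_; _≢_; refl; sym; subst)
open import Relation.Binary.Construct.Closure.ReflexiveTransitive using (Star; ε; _◅_)

data Label : Set where
  ⊥ˡ ⊤ˡ : Label
  var   : ℕ → Label
  ¬ˡ □ˡ : Label
  ∧ˡ ∨ˡ →ˡ : Label

arity : Label → ℕ
arity ⊥ˡ = 0
arity ⊤ˡ = 0
arity (var _) = 0
arity ¬ˡ = 1
arity □ˡ = 1
arity ∧ˡ = 2
arity ∨ˡ = 2
arity →ˡ = 2

isVar : ℕ → Label → Bool
isVar p (var q) = p ≡ᵇ q
isVar p _ = false

-- Graphs ⟨V, r, S, λ⟩ with V = Fin size (finite); S v is the ordered
-- list of successors, of length arity (λ v).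
-- (Reachability from the root is a separate predicate.)

record Graph : Set where
  constructor graph
  field
    size : ℕ
    root : Fin size
    lab  : Fin size → Label
    succ : (v : Fin size) → Vec (Fin size) (arity (lab v))

open Graph public

Edge : (g : Graph) → Fin (size g) → Fin (size g) → Set
Edge g u v = Σ (Fin (arity (lab g u))) λ i → lookup (succ g u) i ≡ v

AllReachable : Graph → Set
AllReachable g = ∀ v → Star (Edge g) (root g) v

IsCycle : (g : Graph) → List (Fin (size g)) → Set
IsCycle g [] = ⊥
IsCycle g (v ∷ vs) = Unique (v ∷ vs) × Linked (Edge g) ((v ∷ vs) ∷ʳ v)

CyclesBoxed : Graph → Set
CyclesBoxed g = ∀ c → IsCycle g c → Any (λ v → lab g v ≡ □ˡ) c

CyclicFormula : Graph → Set
CyclicFormula g = AllReachable g × CyclesBoxed g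

IsBisimulation : (g h : Graph) → (Fin (size g) → Fin (size h) → Set) → Set
IsBisimulation g h R =
  ∀ {a a'} → R a a' →
    Σ (lab g a ≡ lab h a') λ e →
      ∀ (i : Fin (arity (lab g a))) →
        R (lookup (succ g a) i) (lookup (succ h a') (subst (λ l → Fin (arity l)) e i))

_≃_ : Graph → Graph → Set₁
g ≃ h = Σ (Fin (size g) → Fin (size h) → Set) λ R →
          IsBisimulation g h R × R (root g) (root h)

⊥G ⊤G : Graph
⊥G = graph 1 zero (λ _ → ⊥ˡ) (λ _ → [])
⊤G = graph 1 zero (λ _ → ⊤ˡ) (λ _ → [])

unG : (l : Label) → arity l ≡ 1 → Graph → Graph
unG l e φ = graph (suc (size φ)) zero lab' succ'
  where
  lab' : Fin (suc (size φ)) → Label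
  lab' zero = l
  lab' (suc v) = lab φ v
  succ' : (v : Fin (suc (size φ))) → Vec (Fin (suc (size φ))) (arity (lab' v))
  succ' zero = subst (Vec (Fin (suc (size φ)))) (sym e) (suc (root φ) ∷ [])
  succ' (suc v) = map suc (succ φ v)

ulab : (φ ψ : Graph) → Fin (size φ + size ψ) → Label
ulab φ ψ v = [ lab φ , lab ψ ]′ (splitAt (size φ) v)

-- successors in a disjoint union, where edges of the left component are
-- sent through f (used for redirecting edges)
usucc⊎ : (φ ψ : Graph) → (Fin (size φ) → Fin (size φ + size ψ)) →
         (x : Fin (size φ) ⊎ Fin (size ψ)) →
         Vec (Fin (size φ + size ψ)) (arity ([ lab φ , lab ψ ]′ x))
usucc⊎ φ ψ f (inj₁ a) = map f (succ φ a)
usucc⊎ φ ψ f (inj₂ b) = map (size φ ↑ʳ_) (succ ψ b)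

usucc : (φ ψ : Graph) → (Fin (size φ) → Fin (size φ + size ψ)) →
        (v : Fin (size φ + size ψ)) → Vec (Fin (size φ + size ψ)) (arity (ulab φ ψ v))
usucc φ ψ f v = usucc⊎ φ ψ f (splitAt (size φ) v)

binG : (l : Label) → arity l ≡ 2 → Graph → Graph → Graph
binG l e φ ψ = graph (suc (size φ + size ψ)) zero lab' succ'
  where
  lab' : Fin (suc (size φ + size ψ)) → Label
  lab' zero = l
  lab' (suc v) = ulab φ ψ v
  succ' : (v : Fin (suc (size φ + size ψ))) → Vec (Fin (suc (size φ + size ψ))) (arity (lab' v))
  succ' zero = subst (Vec (Fin (suc (size φ + size ψ)))) (sym e)
                 (suc (root φ ↑ˡ size ψ) ∷ suc (size φ ↑ʳ root ψ) ∷ [])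
  succ' (suc v) = map suc (usucc φ ψ (_↑ˡ size ψ) v)

varG : ℕ → Graph
varG p = graph 1 zero (λ _ → var p) (λ _ → [])

¬G □G : Graph → Graph
¬G = unG ¬ˡ refl
□G = unG □ˡ refl

_∧G_ _∨G_ _⇒G_ _⇔G_ : Graph → Graph → Graph
_∧G_ = binG ∧ˡ refl
_∨G_ = binG ∨ˡ refl
_⇒G_ = binG →ˡ refl
φ ⇔G ψ = (φ ⇒G ψ) ∧G (ψ ⇒G φ)

infixr 5 _⇒G_

data PForm : Set where
  pv : ℕ → PForm
  p⊥ p⊤ : PForm
  p¬ : PForm → PForm
  _p∧_ _p∨_ _p→_ : PForm → PForm → PForm

eval : (ℕ → Bool) → PForm → Bool
eval ρ (pv i) = ρ i
eval ρ p⊥ = false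
eval ρ p⊤ = true
eval ρ (p¬ a) = if eval ρ a then false else true
eval ρ (a p∧ b) = if eval ρ a then eval ρ b else false
eval ρ (a p∨ b) = if eval ρ a then true else eval ρ b
eval ρ (a p→ b) = if eval ρ a then eval ρ b else true

Tautology : PForm → Set
Tautology t = ∀ ρ → eval ρ t ≡ true

inst : (ℕ → Graph) → PForm → Graph
inst σ (pv i) = σ i
inst σ p⊥ = ⊥G
inst σ p⊤ = ⊤G
inst σ (p¬ a) = ¬G (inst σ a)
inst σ (a p∧ b) = inst σ a ∧G inst σ b
inst σ (a p∨ b) = inst σ a ∨G inst σ b
inst σ (a p→ b) = inst σ a ⇒G inst σ b

-- The calculus CHL (side conditions: all formulas involved satisfy the
-- cycle condition; unreachable vertices are allowed)

data ⊢_ : Graph → Set₁ where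
  taut : ∀ (t : PForm) (σ : ℕ → Graph) → Tautology t →
         (∀ i → CyclesBoxed (σ i)) → ⊢ inst σ t
  kax  : ∀ φ ψ → CyclesBoxed φ → CyclesBoxed ψ →
         ⊢ (□G (φ ⇒G ψ) ⇒G (□G φ ⇒G □G ψ))
  bis  : ∀ φ ψ → CyclesBoxed φ → CyclesBoxed ψ → φ ≃ ψ → ⊢ (φ ⇔G ψ)
  mp   : ∀ φ ψ → CyclesBoxed ψ → ⊢ φ → ⊢ (φ ⇒G ψ) → ⊢ ψ
  nec  : ∀ φ → ⊢ φ → ⊢ □G φ
  löb  : ∀ φ → ⊢ (□G φ ⇒G φ) → ⊢ φ

verts : ∀ (g : Graph) {u v} → Star (Edge g) u v → List (Fin (size g))
verts g {u = u} ε = u ∷ []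
verts g {u = u} (e ◅ π) = u ∷ verts g π

Modalised : ℕ → Graph → Set
Modalised p ψ = ∀ v → lab ψ v ≡ var p → (π : Star (Edge ψ) (root ψ) v) →
                Any (λ u → lab ψ u ≡ □ˡ) (verts ψ π)

Fresh : ℕ → Graph → Set
Fresh q φ = ∀ v → lab φ v ≢ var q

-- φ[p:ψ] : disjoint union, each p-labelled vertex of φ identified with the
-- root of ψ (p-labelled vertices of φ are left behind unreachable)
_[_∶_] : Graph → ℕ → Graph → Graph
φ [ p ∶ ψ ] = graph (size φ + size ψ) (red (root φ)) (ulab φ ψ) (usucc φ ψ red)
  where
  red : Fin (size φ) → Fin (size φ + size ψ)
  red w = if isVar p (lab φ w) then size φ ↑ʳ root ψ else w ↑ˡ size ψ

-- ϝp.ψ : root identified with all p-labelled vertices (keeping root label)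
ϝ : ℕ → Graph → Graph
ϝ p ψ = graph (size ψ) (root ψ) (lab ψ) (λ v → map red (succ ψ v))
  where
  red : Fin (size ψ) → Fin (size ψ)
  red w = if isVar p (lab ψ w) then root ψ else w

RootOnCycle : Graph → Set
RootOnCycle φ = ∃ λ c → IsCycle φ c × root φ ∈ c

⟨_/var_⟩ : (φ : Graph) → ℕ → Dec (RootOnCycle φ) → Graph
⟨ φ /var q ⟩ (no _) = φ
⟨ φ /var q ⟩ (yes _) = graph (suc (size φ)) (suc (root φ)) lab' succ'
  where
  lab' : Fin (suc (size φ)) → Label
  lab' zero = var q
  lab' (suc v) = lab φ v
  red : Fin (size φ) → Fin (suc (size φ))
  red w = if ⌊ w ≟ root φ ⌋ then zero else suc w
  succ' : (v : Fin (suc (size φ))) → Vec (Fin (suc (size φ))) (arity (lab' v))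
  succ' zero = []
  succ' (suc v) = map red (succ φ v)

⟨_/_⟩ : (φ χ : Graph) → (q : ℕ) → Dec (RootOnCycle φ) → Graph
⟨ φ / χ ⟩ q d = (⟨ φ /var q ⟩ d) [ q ∶ χ ]

-- Both equivalences are instances of the bisimulation axiom: φ is bisimilar to
-- ⟨φ/φ⟩ and ϝp.ψ to ψ[p:ϝp.ψ], in each case by relating a vertex to its copies
-- in the two summands of the substitution. What needs an argument is the side
-- condition that both sides are cyclic formulas. A cycle of φ[p:χ] lies in one
-- summand, since nothing leads from the χ-part back into the φ-part; a cycle of
-- ⟨φ/q⟩ avoids the new leaf; and a cycle of ϝp.ψ through the root either is a
-- cycle of ψ or closes up a path of ψ from the root to a p-vertex, which is
-- boxed because ψ is modalised in p.
module Submission where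

open import Defs
open import Data.Nat using (ℕ; zero; suc; _+_)
open import Data.Fin using (Fin; zero; suc; splitAt; _↑ˡ_; _↑ʳ_; _≟_)
open import Data.Fin.Properties using (splitAt-↑ˡ; splitAt-↑ʳ; splitAt⁻¹-↑ˡ; splitAt⁻¹-↑ʳ; ↑ˡ-injective; ↑ʳ-injective; suc-injective)
open import Data.Bool using (true; false; if_then_else_; T)
open import Data.Unit using (tt)
open import Data.Vec using (Vec; lookup) renaming (map to vmap)
open import Data.Vec.Properties using (lookup-map)
open import Data.List using (List; []; _∷_; _∷ʳ_; _++_; map; [_])
open import Data.List.Properties using (++-assoc; map-++)
open import Data.List.Relation.Unary.Linked using (Linked; []; [-]; _∷_)
open import Data.List.Relation.Unary.AllPairs using (_∷_)
open import Data.List.Relation.Unary.Any using (Any; here; there; any?)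
import Data.List.Relation.Unary.Any as Any
import Data.List.Relation.Unary.Any.Properties as Anyₚ
open import Data.List.Relation.Unary.All using (All; []; _∷_)
import Data.List.Relation.Unary.All as All
import Data.List.Relation.Unary.All.Properties as Allₚ
import Data.List.Relation.Unary.Unique.Propositional.Properties as Uniqueₚ
import Data.List.Relation.Binary.Permutation.Setoid.Properties as Permₚ
open import Data.List.Membership.Propositional.Properties using (∈-∃++)
open import Data.Nat.Properties using (≡ᵇ⇒≡)
open import Data.Sum using (_⊎_; inj₁; inj₂; [_,_]′)
open import Data.Product using (Σ; ∃; _×_; _,_)
open import Data.Empty using (⊥-elim)
open import Function using (id)
open import Relation.Nullary using (Dec; yes; no)
open import Relation.Nullary.Decidable using (⌊_⌋)
open import Relation.Binary.PropositionalEquality using (_≡_; _≢_; refl; sym; trans; subst; subst₂; cong; setoid)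
open import Relation.Binary.Construct.Closure.ReflexiveTransitive using (Star; ε; _◅_)

module _ {A : Set} {R : A → A → Set} where

  Linked-split : ∀ xs {y ys} → Linked R (xs ++ y ∷ ys) → Linked R (xs ∷ʳ y) × Linked R (y ∷ ys)
  Linked-split [] L = [-] , L
  Linked-split (x ∷ []) (r ∷ L) = r ∷ [-] , L
  Linked-split (x ∷ x′ ∷ xs) (r ∷ L) with L₁ , L₂ ← Linked-split (x′ ∷ xs) L = r ∷ L₁ , L₂

  Linked-join : ∀ xs {y ys} → Linked R (xs ∷ʳ y) → Linked R (y ∷ ys) → Linked R (xs ++ y ∷ ys)
  Linked-join [] _ L = L
  Linked-join (x ∷ []) (r ∷ _) L = r ∷ L
  Linked-join (x ∷ x′ ∷ xs) (r ∷ L₁) L = r ∷ Linked-join (x′ ∷ xs) L₁ L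

  Linked-rotate : ∀ a as r bs → Linked R ((a ∷ as ++ r ∷ bs) ∷ʳ a) → Linked R ((r ∷ bs ++ a ∷ as) ∷ʳ r)
  Linked-rotate a as r bs L
    with L₁ , L₂ ← Linked-split (a ∷ as) (subst (Linked R) (++-assoc (a ∷ as) (r ∷ bs) [ a ]) L)
    = subst (Linked R) (cong (r ∷_) (sym (++-assoc bs (a ∷ as) [ r ]))) (Linked-join (r ∷ bs) L₂ L₁)

  Linked⇒All-successor : ∀ xs {y} → Linked R (xs ∷ʳ y) → All (λ x → ∃ (R x)) xs
  Linked⇒All-successor [] _ = []
  Linked⇒All-successor (x ∷ []) (r ∷ _) = (_ , r) ∷ []
  Linked⇒All-successor (x ∷ x′ ∷ xs) (r ∷ L) = (x′ , r) ∷ Linked⇒All-successor (x′ ∷ xs) L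

  module _ {P : A → Set} (closed : ∀ {x y} → R x y → P x → P y) where

    Linked-last : ∀ xs {y} → Linked R (xs ∷ʳ y) → Any P xs → P y
    Linked-last (x ∷ []) (r ∷ [-]) (here px) = closed r px
    Linked-last (x ∷ x′ ∷ xs) (r ∷ L) (here px) = Linked-last (x′ ∷ xs) L (here (closed r px))
    Linked-last (x ∷ x′ ∷ xs) (r ∷ L) (there pxs) = Linked-last (x′ ∷ xs) L pxs

    Linked-all : ∀ {x xs} → Linked R (x ∷ xs) → P x → All P (x ∷ xs)
    Linked-all [-] px = px ∷ []
    Linked-all (r ∷ L) px = px ∷ Linked-all L (closed r px)

    closed-walk-all : ∀ x xs → Linked R ((x ∷ xs) ∷ʳ x) → Any P (x ∷ xs) → All P (x ∷ xs)
    closed-walk-all x xs L pxs = Allₚ.++⁻ˡ (x ∷ xs) (Linked-all L (Linked-last (x ∷ xs) L pxs))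

Any⊎All : ∀ {A : Set} {P Q : A → Set} {xs} → All (λ x → P x ⊎ Q x) xs → Any P xs ⊎ All Q xs
Any⊎All [] = inj₂ []
Any⊎All (inj₁ px ∷ _) = inj₁ (here px)
Any⊎All (inj₂ qx ∷ pqs) with Any⊎All pqs
... | inj₁ pxs = inj₁ (there pxs)
... | inj₂ qxs = inj₂ (qx ∷ qxs)

Vertex : Graph → Set
Vertex g = Fin (size g)

Boxed : (g : Graph) → Vertex g → Set
Boxed g v = lab g v ≡ □ˡ

IsCycle-rotate : ∀ (g : Graph) a as r bs → IsCycle g (a ∷ as ++ r ∷ bs) → IsCycle g (r ∷ bs ++ a ∷ as)
IsCycle-rotate g a as r bs (unique , L) =
  Permₚ.Unique-resp-↭ (setoid (Vertex g)) (Permₚ.++-comm (setoid (Vertex g)) (a ∷ as) (r ∷ bs)) unique ,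
  Linked-rotate a as r bs L

module _ (g h : Graph) (emb : Vertex h → Vertex g)
         (S : Vertex g → Set) (S⊆image : ∀ {u} → S u → ∃ λ v → emb v ≡ u)
         (reflect-edge : ∀ {v v′} → S (emb v′) → Edge g (emb v) (emb v′) → Edge h v v′)
         (preserve-box : ∀ {v} → Boxed h v → Boxed g (emb v)) where

  private
    preimage : ∀ {c} → All S c → Σ (List (Vertex h)) λ d → map emb d ≡ c × All (λ v → S (emb v)) d
    preimage [] = [] , refl , []
    preimage (s ∷ ss) with S⊆image s | preimage ss
    ... | v , refl | d , refl , sd = v ∷ d , refl , s ∷ sd

    reflect-walk : ∀ {d} → All (λ v → S (emb v)) d → Linked (Edge g) (map emb d) → Linked (Edge h) d
    reflect-walk [] _ = []
    reflect-walk (_ ∷ []) _ = [-]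
    reflect-walk (_ ∷ sd@(s ∷ _)) (e ∷ L) = reflect-edge s e ∷ reflect-walk sd L

  cycle-image-boxed : CyclesBoxed h → ∀ c → IsCycle g c → All S c → Any (Boxed g) c
  cycle-image-boxed cbh c cyc sc with preimage sc
  cycle-image-boxed cbh .(map emb (v ∷ d)) (unique , L) sc | v ∷ d , refl , sd =
    Anyₚ.map⁺ (Any.map preserve-box (cbh (v ∷ d) (Uniqueₚ.map⁻ unique , reflect-walk sd′ L′)))
    where
    sd′ : All (λ v → S (emb v)) ((v ∷ d) ∷ʳ v)
    sd′ = Allₚ.∷ʳ⁺ sd (All.head sd)
    L′ : Linked (Edge g) (map emb ((v ∷ d) ∷ʳ v))
    L′ = subst (Linked (Edge g)) (sym (map-++ emb (v ∷ d) [ v ])) L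

isVar-true : ∀ p l → isVar p l ≡ true → l ≡ var p
isVar-true p (var q) eq = cong var (sym (≡ᵇ⇒≡ p q (subst T (sym eq) tt)))

isVar-fresh : ∀ q l → l ≢ var q → isVar q l ≡ false
isVar-fresh q l l≢q with isVar q l in eq
... | true = ⊥-elim (l≢q (isVar-true q l eq))
... | false = refl

isVar-refl : ∀ q → isVar q (var q) ≡ true
isVar-refl zero = refl
isVar-refl (suc q) = isVar-refl q

↑ˡ≢↑ʳ : ∀ {n m} (x : Fin n) (y : Fin m) → x ↑ˡ m ≢ n ↑ʳ y
↑ˡ≢↑ʳ {n} {m} x y eq with () ← trans (sym (splitAt-↑ˡ n x m)) (trans (cong (splitAt n) eq) (splitAt-↑ʳ n m y))

-- The edge redirections in the definitions of _[_∶_], ϝ and ⟨_/var_⟩.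
redirect : (X Y : Graph) → ℕ → Vertex X → Fin (size X + size Y)
redirect X Y p w = if isVar p (lab X w) then size X ↑ʳ root Y else w ↑ˡ size Y

fold : (ψ : Graph) → ℕ → Vertex ψ → Vertex ψ
fold ψ p w = if isVar p (lab ψ w) then root ψ else w

cut : (φ : Graph) → Vertex φ → Fin (suc (size φ))
cut φ w = if ⌊ w ≟ root φ ⌋ then zero else suc w

redirect-fresh : ∀ X Y {p} w → lab X w ≢ var p → redirect X Y p w ≡ w ↑ˡ size Y
redirect-fresh X Y {p} w fresh rewrite isVar-fresh p (lab X w) fresh = refl

module _ {X Y : Graph} {p : ℕ} where
  private
    n m : ℕ
    n = size X
    m = size Y

    U : Graph
    U = X [ p ∶ Y ]

    -- Edge U b u unfolds to EdgeFrom (splitAt n b) u.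
    EdgeFrom : (s : Fin n ⊎ Fin m) → Fin (n + m) → Set
    EdgeFrom s u = Σ (Fin (arity ([ lab X , lab Y ]′ s))) λ i → lookup (usucc⊎ X Y (redirect X Y p) s) i ≡ u

  edge-↑ˡ : ∀ {x u} → Edge U (x ↑ˡ m) u → ∃ λ x′ → Edge X x x′ × redirect X Y p x′ ≡ u
  edge-↑ˡ {x} {u} e with i , eq ← subst (λ s → EdgeFrom s u) (splitAt-↑ˡ n x m) e
    = lookup (succ X x) i , (i , refl) , trans (sym (lookup-map i (redirect X Y p) (succ X x))) eq

  edge-↑ʳ : ∀ {y u} → Edge U (n ↑ʳ y) u → ∃ λ y′ → Edge Y y y′ × n ↑ʳ y′ ≡ u
  edge-↑ʳ {y} {u} e with i , eq ← subst (λ s → EdgeFrom s u) (splitAt-↑ʳ n m y) e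
    = lookup (succ Y y) i , (i , refl) , trans (sym (lookup-map i (n ↑ʳ_) (succ Y y))) eq

  redirect-↑ˡ : ∀ w {x} → redirect X Y p w ≡ x ↑ˡ m → w ≡ x
  redirect-↑ˡ w {x} eq with isVar p (lab X w)
  ... | true = ⊥-elim (↑ˡ≢↑ʳ x (root Y) (sym eq))
  ... | false = ↑ˡ-injective m w x eq

  InLeft InRight : Fin (n + m) → Set
  InLeft u = ∃ λ x → x ↑ˡ m ≡ u
  InRight u = ∃ λ y → n ↑ʳ y ≡ u

  InRight⊎InLeft : ∀ u → InRight u ⊎ InLeft u
  InRight⊎InLeft u with splitAt n u in eq
  ... | inj₁ x = inj₂ (x , splitAt⁻¹-↑ˡ eq)
  ... | inj₂ y = inj₁ (y , splitAt⁻¹-↑ʳ eq)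

  InRight-closed : ∀ {u w} → Edge U u w → InRight u → InRight w
  InRight-closed e (y , refl) with y′ , _ , eq ← edge-↑ʳ e = y′ , eq

  substitution-cyclesBoxed : CyclesBoxed X → CyclesBoxed Y → CyclesBoxed (X [ p ∶ Y ])
  substitution-cyclesBoxed cbX cbY c@(v ∷ vs) cyc@(_ , L)
    with Any⊎All (All.universal InRight⊎InLeft c)
  ... | inj₁ someRight =
    cycle-image-boxed U Y (n ↑ʳ_) InRight id
      (λ _ e → let y′ , e′ , eq = edge-↑ʳ e in subst (Edge Y _) (↑ʳ-injective n _ _ eq) e′)
      (λ {y} b → trans (cong [ lab X , lab Y ]′ (splitAt-↑ʳ n m y)) b)
      cbY c cyc (closed-walk-all InRight-closed v vs L someRight)
  ... | inj₂ allLeft =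
    cycle-image-boxed U X (_↑ˡ m) InLeft id
      (λ _ e → let x′ , e′ , eq = edge-↑ˡ e in subst (Edge X _) (redirect-↑ˡ x′ eq) e′)
      (λ {x} b → trans (cong [ lab X , lab Y ]′ (splitAt-↑ˡ n x m)) b)
      cbX c cyc allLeft

hole-cyclesBoxed : ∀ {φ q} (d : Dec (RootOnCycle φ)) → CyclesBoxed φ → CyclesBoxed (⟨ φ /var q ⟩ d)
hole-cyclesBoxed (no _) cbφ = cbφ
hole-cyclesBoxed {φ} {q} (yes r) cbφ c@(v ∷ vs) cyc@(_ , L) =
  cycle-image-boxed X φ suc (λ u → ∃ λ w → suc w ≡ u) id reflect-edge id
    cbφ c cyc (All.map notLeaf (Linked⇒All-successor (v ∷ vs) L))
  where
  X : Graph
  X = ⟨ φ /var q ⟩ (yes r)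

  -- The new leaf has no successors, so it lies on no cycle.
  notLeaf : ∀ {u} → ∃ (Edge X u) → ∃ λ w → suc w ≡ u
  notLeaf {suc w} _ = w , refl

  cut-suc : ∀ w {w′} → cut φ w ≡ suc w′ → w ≡ w′
  cut-suc w eq with w ≟ root φ
  cut-suc w () | yes _
  cut-suc w eq | no _ = suc-injective eq

  reflect-edge : ∀ {w w′} → ∃ (λ x → suc x ≡ suc w′) → Edge X (suc w) (suc w′) → Edge φ w w′
  reflect-edge {w} _ (i , eq) = i , cut-suc _ (trans (sym (lookup-map i _ (succ φ w))) eq)

module _ {ψ : Graph} {p : ℕ} where
  private
    F : Graph
    F = ϝ p ψ

  fold-cases : ∀ w {v} → fold ψ p w ≡ v → w ≡ v ⊎ (v ≡ root ψ × lab ψ w ≡ var p)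
  fold-cases w eq with isVar p (lab ψ w) in isP
  ... | true = inj₂ (sym eq , isVar-true p _ isP)
  ... | false = inj₁ eq

  ϝ-edge : ∀ {u w} → Edge F u w → Edge ψ u w ⊎ (w ≡ root ψ × ∃ λ x → Edge ψ u x × lab ψ x ≡ var p)
  ϝ-edge {u} (i , eq) with fold-cases (lookup (succ ψ u) i) (trans (sym (lookup-map i _ (succ ψ u))) eq)
  ... | inj₁ same = inj₁ (i , same)
  ... | inj₂ (v≡r , isP) = inj₂ (v≡r , _ , (i , refl) , isP)

  -- The only edges of ϝ p ψ that are not edges of ψ end in the root.
  ϝ-walk-to-root : ∀ u ws → Linked (Edge F) (u ∷ ws ∷ʳ root ψ) → All (root ψ ≢_) ws →
    Linked (Edge ψ) (u ∷ ws ∷ʳ root ψ) ⊎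
    Σ (Vertex ψ) λ x → lab ψ x ≡ var p × Σ (Star (Edge ψ) u x) λ π → verts ψ π ≡ u ∷ ws ∷ʳ x
  ϝ-walk-to-root u [] (e ∷ [-]) [] with ϝ-edge e
  ... | inj₁ e′ = inj₁ (e′ ∷ [-])
  ... | inj₂ (_ , x , e′ , isP) = inj₂ (x , isP , e′ ◅ ε , refl)
  ϝ-walk-to-root u (w ∷ ws) (e ∷ L) (r≢w ∷ r≢ws) with ϝ-edge e
  ... | inj₂ (w≡r , _) = ⊥-elim (r≢w (sym w≡r))
  ... | inj₁ e′ with ϝ-walk-to-root w ws L r≢ws
  ...   | inj₁ L′ = inj₁ (e′ ∷ L′)
  ...   | inj₂ (x , isP , π , eq) = inj₂ (x , isP , e′ ◅ π , cong (u ∷_) eq)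

  ϝ-cycle-from-root : Modalised p ψ → CyclesBoxed ψ → ∀ ws → IsCycle F (root ψ ∷ ws) → Any (Boxed F) (root ψ ∷ ws)
  ϝ-cycle-from-root modalised cbψ ws (unique@(r∉ws ∷ _) , L) with ϝ-walk-to-root (root ψ) ws L r∉ws
  ... | inj₁ L′ = cbψ (root ψ ∷ ws) (unique , L′)
  ... | inj₂ (x , isP , π , eq)
    with Anyₚ.++⁻ (root ψ ∷ ws) (subst (Any (Boxed ψ)) eq (modalised x isP π))
  ...   | inj₁ boxed = boxed
  ...   | inj₂ (here xBoxed) with () ← trans (sym isP) xBoxed

  ϝ-cyclesBoxed : Modalised p ψ → CyclesBoxed ψ → CyclesBoxed (ϝ p ψ)
  ϝ-cyclesBoxed modalised cbψ c@(_ ∷ _) cyc with any? (root ψ ≟_) c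
  ... | no r∉c =
    cycle-image-boxed F ψ id (root ψ ≢_) (λ _ → _ , refl) reflect-edge id
      cbψ c cyc (Allₚ.¬Any⇒All¬ c r∉c)
    where
    reflect-edge : ∀ {v v′} → root ψ ≢ v′ → Edge F v v′ → Edge ψ v v′
    reflect-edge r≢v′ e = [ id , (λ (v′≡r , _) → ⊥-elim (r≢v′ (sym v′≡r))) ]′ (ϝ-edge e)
  ... | yes r∈c with ∈-∃++ r∈c
  ...   | [] , bs , refl = ϝ-cycle-from-root modalised cbψ bs cyc
  ...   | a ∷ as , bs , refl =
    Permₚ.Any-resp-↭ (setoid (Vertex ψ)) (subst (Boxed F)) (Permₚ.++-comm (setoid (Vertex ψ)) (root ψ ∷ bs) (a ∷ as))
      (ϝ-cycle-from-root modalised cbψ (bs ++ a ∷ as) (IsCycle-rotate F a as (root ψ) bs cyc))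

-- IsBisimulation g h R unfolds to R a a′ → Matches g R a (lab h a′) (succ h a′);
-- separating label and successors lets this be transported along splitAt.
Matches : (g : Graph) {B : Set} → (Vertex g → B → Set) → Vertex g → (l : Label) → Vec B (arity l) → Set
Matches g R a l bs = Σ (lab g a ≡ l) λ e → ∀ i → R (lookup (succ g a) i) (lookup bs (subst (λ l → Fin (arity l)) e i))

Copy : (g X : Graph) → (Vertex g → Vertex X) → Vertex g → Fin (size X + size g) → Set
Copy g X f a b = b ≡ f a ↑ˡ size g ⊎ b ≡ size X ↑ʳ a

module _ (g X : Graph) (p : ℕ) (f : Vertex g → Vertex X) where

  copy-isBisimulation : (∀ a → Matches g (Copy g X f) a (lab X (f a)) (vmap (redirect X g p) (succ X (f a)))) →
                        IsBisimulation g (X [ p ∶ g ]) (Copy g X f)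
  copy-isBisimulation matchX {a} (inj₁ refl) =
    subst (λ s → Matches g (Copy g X f) a ([ lab X , lab g ]′ s) (usucc⊎ X g (redirect X g p) s))
      (sym (splitAt-↑ˡ (size X) (f a) (size g))) (matchX a)
  copy-isBisimulation matchX {a} (inj₂ refl) =
    subst (λ s → Matches g (Copy g X f) a ([ lab X , lab g ]′ s) (usucc⊎ X g (redirect X g p) s))
      (sym (splitAt-↑ʳ (size X) (size g) a))
      (refl , λ i → inj₂ (lookup-map i (size X ↑ʳ_) (succ g a)))

≃-⟨/⟩ : ∀ {φ q} → Fresh q φ → (d : Dec (RootOnCycle φ)) → φ ≃ ⟨ φ / φ ⟩ q d
≃-⟨/⟩ {φ} {q} fresh (no _) =
  Copy φ φ id , copy-isBisimulation φ φ q id match , inj₁ (redirect-fresh φ φ (root φ) (fresh (root φ)))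
  where
  match : ∀ a → Matches φ (Copy φ φ id) a (lab φ a) (vmap (redirect φ φ q) (succ φ a))
  match a = refl , λ i → inj₁ (trans (lookup-map i _ (succ φ a)) (redirect-fresh φ φ _ (fresh _)))
≃-⟨/⟩ {φ} {q} fresh (yes r) =
  Copy φ X suc , copy-isBisimulation φ X q suc match , inj₁ (redirect-fresh X φ (suc (root φ)) (fresh (root φ)))
  where
  X : Graph
  X = ⟨ φ /var q ⟩ (yes r)

  -- Edges into the root of φ are cut at the leaf q, which is then replaced by φ.
  cut-copy : ∀ y → Copy φ X suc y (redirect X φ q (cut φ y))
  cut-copy y with y ≟ root φ
  ... | yes refl rewrite isVar-refl q = inj₂ refl
  ... | no _ = inj₁ (redirect-fresh X φ (suc y) (fresh y))

  match : ∀ a → Matches φ (Copy φ X suc) a (lab φ a) (vmap (redirect X φ q) (succ X (suc a)))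
  match a = refl , λ i →
    subst (Copy φ X suc _)
      (sym (trans (lookup-map i _ (succ X (suc a))) (cong (redirect X φ q) (lookup-map i _ (succ φ a)))))
      (cut-copy (lookup (succ φ a) i))

ϝ-≃-unfold : ∀ ψ p → ϝ p ψ ≃ (ψ [ p ∶ ϝ p ψ ])
ϝ-≃-unfold ψ p = Copy F ψ id , copy-isBisimulation F ψ p id match , root-copy
  where
  F : Graph
  F = ϝ p ψ

  root-copy : Copy F ψ id (root ψ) (redirect ψ F p (root ψ))
  root-copy with isVar p (lab ψ (root ψ))
  ... | true = inj₂ refl
  ... | false = inj₁ refl

  unfold-copy : ∀ y → Copy F ψ id (fold ψ p y) (redirect ψ F p y)
  unfold-copy y with isVar p (lab ψ y)
  ... | true = inj₂ refl
  ... | false = inj₁ refl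

  match : ∀ a → Matches F (Copy F ψ id) a (lab ψ a) (vmap (redirect ψ F p) (succ ψ a))
  match a = refl , λ i →
    subst₂ (Copy F ψ id) (sym (lookup-map i _ (succ ψ a))) (sym (lookup-map i _ (succ ψ a)))
      (unfold-copy (lookup (succ ψ a) i))

theorem3p2 :
    (∀ (φ : Graph) → CyclicFormula φ →
       (q : ℕ) → Fresh q φ → (d : Dec (RootOnCycle φ)) →
       ⊢ (φ ⇔G (⟨ φ / φ ⟩ q d)))
    ×
    (∀ (ψ : Graph) (p : ℕ) → CyclicFormula ψ → Modalised p ψ →
       ⊢ (ϝ p ψ ⇔G (ψ [ p ∶ ϝ p ψ ])))
theorem3p2 = unfold-⟨/⟩ , unfold-ϝ
  where
  unfold-⟨/⟩ : ∀ φ → CyclicFormula φ → ∀ q → Fresh q φ → (d : Dec (RootOnCycle φ)) → ⊢ (φ ⇔G (⟨ φ / φ ⟩ q d))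
  unfold-⟨/⟩ φ (_ , cbφ) q fresh d =
    bis φ (⟨ φ / φ ⟩ q d) cbφ (substitution-cyclesBoxed (hole-cyclesBoxed d cbφ) cbφ) (≃-⟨/⟩ fresh d)

  unfold-ϝ : ∀ ψ p → CyclicFormula ψ → Modalised p ψ → ⊢ (ϝ p ψ ⇔G (ψ [ p ∶ ϝ p ψ ]))
  unfold-ϝ ψ p (_ , cbψ) modalised =
    bis (ϝ p ψ) (ψ [ p ∶ ϝ p ψ ]) cbF (substitution-cyclesBoxed cbψ cbF) (ϝ-≃-unfold ψ p)
    where
    cbF : CyclesBoxed (ϝ p ψ)
    cbF = ϝ-cyclesBoxed modalised cbψ
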